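{- For all integers $n\ge0$ and $m$, the mapping $\gamma$ (applied at the columns $c=3i+2$, $0\le i<n$) is a bijection from the set of Schröder paths (respectively Delannoy paths) from $(0,0)$ to $(3n,m)$ that are smooth at each horizontal distance $3i+2$ from the origin for $0\le i<n$, to the set of vertically constrained $S_{CW}$ paths from $(0,0)$ to $(n,m)$ whose first step (if any) lies in $S_C$ and all of whose vertices have $y\ge0$ (respectively, with no height restriction).
   Context: A lattice path is a finite sequence of steps (vectors in $\mathbb{Z}^2$) starting at $(0,0)$; its vertices are the partial sums. Let $S_C=\{(1,1),(1,-1),(2,0)\}$. A Delannoy path is a lattice path with steps in $S_C$; a Schröder path is a Delannoy path all of whose vertices have $y\ge0$. A path is smooth at the integer column $x=c$ if either it contains a step $(2,0)$ from $(c-1,y)$ to $(c+1,y)$ for some $y$, or it has a vertex with $x$-coordinate $c$ and the step ending at that vertex equals the step starting at it (two consecutive equal steps $(1,1)(1,1)$, $(1,-1)(1,-1)$ or $(2,0)(2,0)$ meeting at $x=c$). The map $\gamma$ performs, at each designated column $c$, the substitution: $(1,1)(1,1)$ meeting at $c$ $\mapsto(0,2)$; $(1,-1)(1,-1)$ meeting at $c$ $\mapsto(0,-2)$; $(2,0)(2,0)$ meeting at $c$ $\mapsto(2,0)$; a single $(2,0)$ step with midpoint at $x=c$ is removed; all other steps are kept and the resulting steps concatenated in order. Let $S_{CW}=S_C\cup\{(0,2),(0,-2)\}$, with $(0,\pm2)$ vertical; a vertically constrained $S_{CW}$ path is a lattice path with steps in $S_{CW}$ with no two consecutive vertical steps.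 -}

module Defs where

open import Data.Nat using (ℕ; zero; suc; _+_; _*_; _<_; _%_; _≡ᵇ_; _<ᵇ_)
open import Data.Integer using (ℤ; +_; -[1+_]) renaming (_+_ to _+ℤ_; _≤_ to _≤ℤ_)
open import Data.Bool using (Bool; true; false; _∧_; if_then_else_)
open import Data.List using (List; []; _∷_; _++_; map; inits)
open import Data.List.Relation.Unary.All using (All)
open import Data.Product using (Σ; _×_; _,_; ∃; proj₂)
open import Data.Sum using (_⊎_)
open import Data.Unit using (⊤)
open import Data.Empty using (⊥)
open import Relation.Nullary using (¬_)
open import Relation.Binary.PropositionalEquality using (_≡_)

-- Steps.  S_CW = S_C ∪ {(0,2),(0,-2)}.
--   up = (1,1), down = (1,-1), flat = (2,0), vup = (0,2), vdown = (0,-2)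

data Step : Set where
  up down flat vup vdown : Step

InSC : Step → Set
InSC up    = ⊤
InSC down  = ⊤
InSC flat  = ⊤
InSC vup   = ⊥
InSC vdown = ⊥

Vertical : Step → Set
Vertical vup   = ⊤
Vertical vdown = ⊤
Vertical _     = ⊥

dx : Step → ℕ
dx up    = 1
dx down  = 1
dx flat  = 2
dx vup   = 0
dx vdown = 0

dy : Step → ℤ
dy up    = + 1
dy down  = -[1+ 0 ]
dy flat  = + 0
dy vup   = + 2
dy vdown = -[1+ 1 ]

-- A lattice path is a list of steps starting at (0,0).
Path : Set
Path = List Step

xEnd : Path → ℕ
xEnd []      = 0
xEnd (s ∷ p) = dx s + xEnd p

yEnd : Path → ℤ
yEnd []      = + 0
yEnd (s ∷ p) = dy s +ℤ yEnd p

endpoint : Path → ℤ × ℤ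
endpoint p = (+ xEnd p , yEnd p)

vertices : Path → List (ℤ × ℤ)
vertices p = map endpoint (inits p)

NonNeg : Path → Set
NonNeg p = All (λ v → + 0 ≤ℤ proj₂ v) (vertices p)

Delannoy : ℕ → ℤ → Path → Set
Delannoy a m p = All InSC p × endpoint p ≡ (+ a , m)

Schroeder : ℕ → ℤ → Path → Set
Schroeder a m p = Delannoy a m p × NonNeg p

SmoothAt : ℕ → Path → Set
SmoothAt c p =
  (Σ Path λ xs → Σ Path λ ys → p ≡ xs ++ flat ∷ ys × suc (xEnd xs) ≡ c)
  ⊎ (Σ Path λ xs → Σ Step λ s → Σ Path λ ys →
       p ≡ xs ++ s ∷ s ∷ ys × xEnd xs + dx s ≡ c)

SmoothCols : ℕ → Path → Set
SmoothCols n p = ∀ i → i < n → SmoothAt (3 * i + 2) p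

VertConstrained : Path → Set
VertConstrained p =
  ¬ (Σ Path λ xs → Σ Step λ s → Σ Step λ t → Σ Path λ ys →
       p ≡ xs ++ s ∷ t ∷ ys × Vertical s × Vertical t)

FirstInSC : Path → Set
FirstInSC []      = ⊤
FirstInSC (s ∷ _) = InSC s

-- vertically constrained S_CW path from (0,0) to (a,m), first step in S_C
-- (every Step is an S_CW step)
CWPath : ℕ → ℤ → Path → Set
CWPath a m p = VertConstrained p × FirstInSC p × endpoint p ≡ (+ a , m)

designated : ℕ → ℕ → Bool
designated n c = (c % 3 ≡ᵇ 2) ∧ (c <ᵇ 3 * n)

pairSub : Step → List Step
pairSub up    = vup ∷ []
pairSub down  = vdown ∷ []
pairSub flat  = flat ∷ []
pairSub vup   = vup ∷ vup ∷ []
pairSub vdown = vdown ∷ vdown ∷ []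

eqStep : Step → Step → Bool
eqStep up    up    = true
eqStep down  down  = true
eqStep flat  flat  = true
eqStep vup   vup   = true
eqStep vdown vdown = true
eqStep _     _     = false

isFlat : Step → Bool
isFlat flat = true
isFlat _    = false

γ' : ℕ → ℕ → Path → Path
γ' n x [] = []
γ' n x (s ∷ []) =
  if isFlat s ∧ designated n (suc x) then [] else s ∷ []
γ' n x (s ∷ rest@(t ∷ rest')) =
  if eqStep s t ∧ designated n (x + dx s)
  then pairSub s ++ γ' n (x + dx s + dx t) rest'
  else (if isFlat s ∧ designated n (suc x)
        then γ' n (x + dx s) rest
        else s ∷ γ' n (x + dx s) rest)

γ : ℕ → Path → Path
γ n p = γ' n 0 p

BijOn : (Path → Path) → (Path → Set) → (Path → Set) → Set
BijOn f A B =
  (∀ p → A p → B (f p))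
  × (∀ p q → A p → A q → f p ≡ f q → p ≡ q)
  × (∀ q → B q → ∃ λ p → A p × f p ≡ q)

-- A Delannoy path from (0,0) to (3n,m) that is smooth at the columns 3i+2 cuts uniquely
-- into blocks starting on columns divisible by 3: a step (1,±1) followed by a crossing of
-- the next designated column (a flat step centred on it, or two equal steps (1,±1) meeting
-- on it), or two flat steps meeting on a designated column followed by such a crossing.
-- γ keeps the first step of a block (one flat for a flat pair) and replaces the crossing by
-- nothing, (0,2) or (0,-2).  The images of block sequences are exactly the vertically
-- constrained S_CW paths whose first step is in S_C, a block sequence is determined by its
-- image, and every height visited by the Delannoy path but not by its image lies between
-- two neighbouring heights of the image, so the correspondence also preserves y ≥ 0.

module Submission where

open import Defs
open import Data.Bool using (true; false)
open import Data.Bool.Properties using (T-≡; ∧-zeroʳ)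
open import Data.Empty using (⊥; ⊥-elim)
open import Data.Integer using (ℤ; +_; -[1+_]) renaming (_+_ to _+ℤ_; _≤_ to _≤ℤ_)
import Data.Integer.Properties as ℤ
open import Data.List using (List; []; _∷_; _++_; inits)
open import Data.List.Properties using (∷-injective)
open import Data.List.Relation.Unary.All as All using (All; []; _∷_)
open import Data.List.Relation.Unary.All.Properties using (++⁺; ++⁻ʳ; map⁺; map⁻)
open import Data.Nat using (ℕ; zero; suc; _+_; _*_; _<_; _≤_; _%_; _≡ᵇ_; z≤n; s≤s)
open import Data.Nat.DivMod using (%-distribˡ-+)
open import Data.Nat.Properties
  using (+-assoc; +-comm; +-suc; +-cancelˡ-≡; +-commutativeSemigroup; *-comm; *-distribˡ-+;
         *-cancelˡ-≡; suc-injective; m+1+n≢m; m≤m+n; m+n≤o⇒m≤o; ≤-reflexive; <-irrefl;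
         <-≤-trans; <⇒<ᵇ)
open import Data.Nat.Tactic.RingSolver using (solve-∀)
open import Algebra.Properties.CommutativeSemigroup +-commutativeSemigroup using (x∙yz≈y∙xz)
open import Data.Product using (∃; ∃₂; _×_; _,_; proj₁; proj₂)
open import Data.Product.Properties using (,-injective)
open import Data.Sum using (_⊎_; inj₁; inj₂)
open import Data.Unit using (⊤; tt)
open import Function using (_∘_; _⇔_; mk⇔; Equivalence)
open import Relation.Nullary using (¬_)
open import Relation.Binary.PropositionalEquality

open Equivalence using (to; from)

data Horizontal : Set where
  hup hdown hflat : Horizontal

data Lift : Set where
  level rise fall : Lift

data Block : Set where
  block : Horizontal → Lift → Block

horizontal : Horizontal → Step
horizontal hup   = up
horizontal hdown = down
horizontal hflat = flat

vertical : Lift → Path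
vertical level = []
vertical rise  = vup ∷ []
vertical fall  = vdown ∷ []

crossing : Lift → Path
crossing level = flat ∷ []
crossing rise  = up ∷ up ∷ []
crossing fall  = down ∷ down ∷ []

delannoyBlock : Block → Path
delannoyBlock (block hup   v) = up ∷ crossing v
delannoyBlock (block hdown v) = down ∷ crossing v
delannoyBlock (block hflat v) = flat ∷ flat ∷ crossing v

cwBlock : Block → Path
cwBlock (block h v) = horizontal h ∷ vertical v

delannoyOf : List Block → Path
delannoyOf []       = []
delannoyOf (b ∷ bs) = delannoyBlock b ++ delannoyOf bs

cwOf : List Block → Path
cwOf []       = []
cwOf (b ∷ bs) = cwBlock b ++ cwOf bs

horizontal-InSC : ∀ h → InSC (horizontal h)
horizontal-InSC hup   = tt
horizontal-InSC hdown = tt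
horizontal-InSC hflat = tt

InSC⇒¬Vertical : ∀ {s} → InSC s → ¬ Vertical s
InSC⇒¬Vertical {up}   _ ()
InSC⇒¬Vertical {down} _ ()
InSC⇒¬Vertical {flat} _ ()

¬Vertical⇒InSC : ∀ s → ¬ Vertical s → InSC s
¬Vertical⇒InSC up    _  = tt
¬Vertical⇒InSC down  _  = tt
¬Vertical⇒InSC flat  _  = tt
¬Vertical⇒InSC vup   nv = ⊥-elim (nv tt)
¬Vertical⇒InSC vdown nv = ⊥-elim (nv tt)

dx-positive : ∀ {s} → InSC s → 0 < dx s
dx-positive {up}   _ = s≤s z≤n
dx-positive {down} _ = s≤s z≤n
dx-positive {flat} _ = s≤s z≤n

crossing-InSC : ∀ v → All InSC (crossing v)
crossing-InSC level = tt ∷ []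
crossing-InSC rise  = tt ∷ tt ∷ []
crossing-InSC fall  = tt ∷ tt ∷ []

delannoyBlock-InSC : ∀ b → All InSC (delannoyBlock b)
delannoyBlock-InSC (block hup   v) = tt ∷ crossing-InSC v
delannoyBlock-InSC (block hdown v) = tt ∷ crossing-InSC v
delannoyBlock-InSC (block hflat v) = tt ∷ tt ∷ crossing-InSC v

delannoyOf-InSC : ∀ bs → All InSC (delannoyOf bs)
delannoyOf-InSC []       = []
delannoyOf-InSC (b ∷ bs) = ++⁺ (delannoyBlock-InSC b) (delannoyOf-InSC bs)

xEnd-++ : ∀ p q → xEnd (p ++ q) ≡ xEnd p + xEnd q
xEnd-++ []      q = refl
xEnd-++ (s ∷ p) q = trans (cong (_+_ (dx s)) (xEnd-++ p q)) (sym (+-assoc (dx s) (xEnd p) (xEnd q)))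

yEnd-++ : ∀ p q → yEnd (p ++ q) ≡ yEnd p +ℤ yEnd q
yEnd-++ []      q = sym (ℤ.+-identityˡ (yEnd q))
yEnd-++ (s ∷ p) q = trans (cong (dy s +ℤ_) (yEnd-++ p q)) (sym (ℤ.+-assoc (dy s) (yEnd p) (yEnd q)))

xEnd-crossing : ∀ v q → xEnd (crossing v ++ q) ≡ 2 + xEnd q
xEnd-crossing level q = refl
xEnd-crossing rise  q = refl
xEnd-crossing fall  q = refl

xEnd-vertical : ∀ v q → xEnd (vertical v ++ q) ≡ xEnd q
xEnd-vertical level q = refl
xEnd-vertical rise  q = refl
xEnd-vertical fall  q = refl

delannoyBlock-displacement : ∀ b →
  xEnd (delannoyBlock b) ≡ 3 * xEnd (cwBlock b) × yEnd (delannoyBlock b) ≡ yEnd (cwBlock b)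
delannoyBlock-displacement (block hup   level) = refl , refl
delannoyBlock-displacement (block hup   rise)  = refl , refl
delannoyBlock-displacement (block hup   fall)  = refl , refl
delannoyBlock-displacement (block hdown level) = refl , refl
delannoyBlock-displacement (block hdown rise)  = refl , refl
delannoyBlock-displacement (block hdown fall)  = refl , refl
delannoyBlock-displacement (block hflat level) = refl , refl
delannoyBlock-displacement (block hflat rise)  = refl , refl
delannoyBlock-displacement (block hflat fall)  = refl , refl

xEnd-delannoyOf : ∀ bs → xEnd (delannoyOf bs) ≡ 3 * xEnd (cwOf bs)
xEnd-delannoyOf []       = refl
xEnd-delannoyOf (b ∷ bs) = begin
  xEnd (delannoyBlock b ++ delannoyOf bs)        ≡⟨ xEnd-++ (delannoyBlock b) _ ⟩
  xEnd (delannoyBlock b) + xEnd (delannoyOf bs)  ≡⟨ cong₂ _+_ (proj₁ (delannoyBlock-displacement b))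
                                                              (xEnd-delannoyOf bs) ⟩
  3 * xEnd (cwBlock b) + 3 * xEnd (cwOf bs)      ≡⟨ sym (*-distribˡ-+ 3 (xEnd (cwBlock b)) _) ⟩
  3 * (xEnd (cwBlock b) + xEnd (cwOf bs))        ≡⟨ cong (3 *_) (sym (xEnd-++ (cwBlock b) _)) ⟩
  3 * xEnd (cwBlock b ++ cwOf bs)                ∎
  where open ≡-Reasoning

yEnd-delannoyOf : ∀ bs → yEnd (delannoyOf bs) ≡ yEnd (cwOf bs)
yEnd-delannoyOf []       = refl
yEnd-delannoyOf (b ∷ bs) = begin
  yEnd (delannoyBlock b ++ delannoyOf bs)         ≡⟨ yEnd-++ (delannoyBlock b) _ ⟩
  yEnd (delannoyBlock b) +ℤ yEnd (delannoyOf bs)  ≡⟨ cong₂ _+ℤ_ (proj₂ (delannoyBlock-displacement b))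
                                                                (yEnd-delannoyOf bs) ⟩
  yEnd (cwBlock b) +ℤ yEnd (cwOf bs)              ≡⟨ sym (yEnd-++ (cwBlock b) _) ⟩
  yEnd (cwBlock b ++ cwOf bs)                     ∎
  where open ≡-Reasoning

endpoint≡ : ∀ p {a m} → endpoint p ≡ (+ a , m) ⇔ (xEnd p ≡ a × yEnd p ≡ m)
endpoint≡ _ = mk⇔ (λ e → let ex , ey = ,-injective e in ℤ.+-injective ex , ey)
                (λ (ex , ey) → cong₂ _,_ (cong +_ ex) ey)

endpoint-delannoyOf : ∀ {a m} bs →
  endpoint (delannoyOf bs) ≡ (+ (3 * a) , m) ⇔ endpoint (cwOf bs) ≡ (+ a , m)
endpoint-delannoyOf bs = mk⇔
  (λ e → let ex , ey = to (endpoint≡ (delannoyOf bs)) e in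
    from (endpoint≡ (cwOf bs)) ( *-cancelˡ-≡ _ _ 3 (trans (sym (xEnd-delannoyOf bs)) ex)
                               , trans (sym (yEnd-delannoyOf bs)) ey))
  (λ e → let ex , ey = to (endpoint≡ (cwOf bs)) e in
    from (endpoint≡ (delannoyOf bs)) ( trans (xEnd-delannoyOf bs) (cong (3 *_) ex)
                                     , trans (yEnd-delannoyOf bs) ey))

%3-+ : ∀ x {r} k → x % 3 ≡ r → (x + k) % 3 ≡ (r + k % 3) % 3
%3-+ x k e = trans (%-distribˡ-+ x k 3) (cong (λ r → (r + k % 3) % 3) e)

+-assoc-≤ : ∀ x a b {N} → x + (a + b) ≤ N → x + a + b ≤ N
+-assoc-≤ x a b {N} = subst (_≤ N) (sym (+-assoc x a b))

+-<-prefix : ∀ x a b {N} → x + (suc a + b) ≤ N → x + a < N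
+-<-prefix x a b {N} le = subst (_≤ N) (+-suc x a) (m+n≤o⇒m≤o (x + suc a) (+-assoc-≤ x (suc a) b le))

eqStep-refl : ∀ s → eqStep s s ≡ true
eqStep-refl up    = refl
eqStep-refl down  = refl
eqStep-refl flat  = refl
eqStep-refl vup   = refl
eqStep-refl vdown = refl

module _ (n : ℕ) where

  designated-on : ∀ {c} → c % 3 ≡ 2 → c < 3 * n → designated n c ≡ true
  designated-on e c<3n rewrite e = to T-≡ (<⇒<ᵇ c<3n)

  designated-off : ∀ {c r} → c % 3 ≡ r → (r ≡ᵇ 2) ≡ false → designated n c ≡ false
  designated-off refl r≢2 rewrite r≢2 = refl

  γ'-keep : ∀ x s rest → isFlat s ≡ false → designated n (x + dx s) ≡ false →
            γ' n x (s ∷ rest) ≡ s ∷ γ' n (x + dx s) rest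
  γ'-keep x s []      notFlat _   rewrite notFlat = refl
  γ'-keep x s (t ∷ _) notFlat off rewrite off | ∧-zeroʳ (eqStep s t) | notFlat = refl

  γ'-dropFlat : ∀ x rest → designated n (x + 1) ≡ true → designated n (x + 2) ≡ false →
                γ' n x (flat ∷ rest) ≡ γ' n (x + 2) rest
  γ'-dropFlat x []      on off rewrite trans (cong (designated n) (+-comm 1 x)) on = refl
  γ'-dropFlat x (t ∷ _) on off
    rewrite off | ∧-zeroʳ (eqStep flat t) | trans (cong (designated n) (+-comm 1 x)) on = refl

  γ'-pair : ∀ x s rest → designated n (x + dx s) ≡ true →
            γ' n x (s ∷ s ∷ rest) ≡ pairSub s ++ γ' n (x + dx s + dx s) rest
  γ'-pair x s rest on rewrite eqStep-refl s | on = refl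

  -- A block starts on a column ≡ 0 and a crossing on a column ≡ 1 (mod 3); the column a
  -- crossing straddles is then ≡ 2 and, by the width bound, < 3n, so it is designated.
  mutual
    γ'-delannoyOf : ∀ x bs → x % 3 ≡ 0 → x + xEnd (delannoyOf bs) ≤ 3 * n →
                    γ' n x (delannoyOf bs) ≡ cwOf bs
    γ'-delannoyOf x [] _ _ = refl
    γ'-delannoyOf x (block hup v ∷ bs) x≡0 le =
      trans (γ'-keep x up (crossing v ++ delannoyOf bs) refl (designated-off (%3-+ x 1 x≡0) refl))
            (cong (up ∷_) (γ'-crossing (x + 1) v bs (%3-+ x 1 x≡0) (+-assoc-≤ x 1 _ le)))
    γ'-delannoyOf x (block hdown v ∷ bs) x≡0 le =
      trans (γ'-keep x down (crossing v ++ delannoyOf bs) refl (designated-off (%3-+ x 1 x≡0) refl))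
            (cong (down ∷_) (γ'-crossing (x + 1) v bs (%3-+ x 1 x≡0) (+-assoc-≤ x 1 _ le)))
    γ'-delannoyOf x (block hflat v ∷ bs) x≡0 le =
      trans (γ'-pair x flat (crossing v ++ delannoyOf bs) (designated-on (%3-+ x 2 x≡0) (+-<-prefix x 2 _ le)))
            (cong (flat ∷_) (γ'-crossing (x + 2 + 2) v bs (%3-+ (x + 2) 2 (%3-+ x 2 x≡0))
                                         (+-assoc-≤ (x + 2) 2 _ (+-assoc-≤ x 2 _ le))))

    γ'-crossing : ∀ y v bs → y % 3 ≡ 1 → y + xEnd (crossing v ++ delannoyOf bs) ≤ 3 * n →
                  γ' n y (crossing v ++ delannoyOf bs) ≡ vertical v ++ cwOf bs
    γ'-crossing y level bs y≡1 le =
      trans (γ'-dropFlat y (delannoyOf bs) (designated-on (%3-+ y 1 y≡1) (+-<-prefix y 1 _ le))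
                                           (designated-off (%3-+ y 2 y≡1) refl))
            (γ'-delannoyOf (y + 2) bs (%3-+ y 2 y≡1) (+-assoc-≤ y 2 _ le))
    γ'-crossing y rise bs y≡1 le =
      trans (γ'-pair y up (delannoyOf bs) (designated-on (%3-+ y 1 y≡1) (+-<-prefix y 1 _ le)))
            (cong (vup ∷_) (γ'-delannoyOf (y + 1 + 1) bs (%3-+ (y + 1) 1 (%3-+ y 1 y≡1))
                                          (+-assoc-≤ (y + 1) 1 _ (+-assoc-≤ y 1 _ le))))
    γ'-crossing y fall bs y≡1 le =
      trans (γ'-pair y down (delannoyOf bs) (designated-on (%3-+ y 1 y≡1) (+-<-prefix y 1 _ le)))
            (cong (vdown ∷_) (γ'-delannoyOf (y + 1 + 1) bs (%3-+ (y + 1) 1 (%3-+ y 1 y≡1))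
                                            (+-assoc-≤ (y + 1) 1 _ (+-assoc-≤ y 1 _ le))))

  γ-delannoyOf : ∀ bs → xEnd (delannoyOf bs) ≡ 3 * n → γ n (delannoyOf bs) ≡ cwOf bs
  γ-delannoyOf bs e = γ'-delannoyOf 0 bs refl (≤-reflexive e)

-- Smoothness

-- The column c is counted from the first vertex of p, so that the definition recurses on p.
SmoothAt′ : ℕ → Path → Set
SmoothAt′ c []      = ⊥
SmoothAt′ c (s ∷ p) = (s ≡ flat × c ≡ 1)
                    ⊎ ((∃ λ p′ → p ≡ s ∷ p′) × c ≡ dx s)
                    ⊎ (∃ λ c′ → c ≡ dx s + c′ × SmoothAt′ c′ p)

SmoothCols′ : ℕ → ℕ → Path → Set
SmoothCols′ c zero    p = ⊤
SmoothCols′ c (suc k) p = SmoothAt′ c p × SmoothCols′ (3 + c) k p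

SmoothAt′-flat : ∀ xs {ys} → SmoothAt′ (suc (xEnd xs)) (xs ++ flat ∷ ys)
SmoothAt′-flat []       = inj₁ (refl , refl)
SmoothAt′-flat (s ∷ xs) = inj₂ (inj₂ (suc (xEnd xs) , sym (+-suc (dx s) (xEnd xs)) , SmoothAt′-flat xs))

SmoothAt′-pair : ∀ xs {s ys} → SmoothAt′ (xEnd xs + dx s) (xs ++ s ∷ s ∷ ys)
SmoothAt′-pair []           = inj₂ (inj₁ ((_ , refl) , refl))
SmoothAt′-pair (t ∷ xs) {s} =
  inj₂ (inj₂ (xEnd xs + dx s , +-assoc (dx t) (xEnd xs) (dx s) , SmoothAt′-pair xs))

SmoothAt⇒SmoothAt′ : ∀ {c p} → SmoothAt c p → SmoothAt′ c p
SmoothAt⇒SmoothAt′ (inj₁ (xs , _ , refl , refl))     = SmoothAt′-flat xs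
SmoothAt⇒SmoothAt′ (inj₂ (xs , _ , _ , refl , refl)) = SmoothAt′-pair xs

SmoothAt′⇒SmoothAt : ∀ {c} p → SmoothAt′ c p → SmoothAt c p
SmoothAt′⇒SmoothAt (s ∷ p) (inj₁ (refl , refl))                = inj₁ ([] , p , refl , refl)
SmoothAt′⇒SmoothAt (s ∷ p) (inj₂ (inj₁ ((p′ , refl) , refl)))  = inj₂ ([] , s , p′ , refl , refl)
SmoothAt′⇒SmoothAt (s ∷ p) (inj₂ (inj₂ (_ , refl , smooth))) with SmoothAt′⇒SmoothAt p smooth
... | inj₁ (xs , ys , refl , refl)     = inj₁ (s ∷ xs , ys , refl , sym (+-suc (dx s) (xEnd xs)))
... | inj₂ (xs , t , ys , refl , refl) = inj₂ (s ∷ xs , t , ys , refl , +-assoc (dx s) (xEnd xs) (dx t))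

column-shift : ∀ i c → 3 * i + (3 + c) ≡ 3 * suc i + c
column-shift = solve-∀

SmoothCols′⇒ : ∀ {c} k {p} → SmoothCols′ c k p → ∀ i → i < k → SmoothAt′ (3 * i + c) p
SmoothCols′⇒ (suc k) (smooth , _) zero _ = smooth
SmoothCols′⇒ (suc k) {p} (_ , smoothCols) (suc i) (s≤s i<k) =
  subst (λ c → SmoothAt′ c p) (column-shift i _) (SmoothCols′⇒ k smoothCols i i<k)

⇒SmoothCols′ : ∀ {c} k {p} → (∀ i → i < k → SmoothAt′ (3 * i + c) p) → SmoothCols′ c k p
⇒SmoothCols′ zero _ = tt
⇒SmoothCols′ (suc k) {p} smooth =
  smooth 0 (s≤s z≤n) ,
  ⇒SmoothCols′ k (λ i i<k → subst (λ c → SmoothAt′ c p) (sym (column-shift i _))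
                                  (smooth (suc i) (s≤s i<k)))

SmoothCols⇒SmoothCols′ : ∀ n {p} → SmoothCols n p → SmoothCols′ 2 n p
SmoothCols⇒SmoothCols′ n smooth = ⇒SmoothCols′ n (λ i i<n → SmoothAt⇒SmoothAt′ (smooth i i<n))

SmoothCols′⇒SmoothCols : ∀ n {p} → SmoothCols′ 2 n p → SmoothCols n p
SmoothCols′⇒SmoothCols n smooth i i<n = SmoothAt′⇒SmoothAt _ (SmoothCols′⇒ n smooth i i<n)

SmoothAt′-tail : ∀ {s c p} → SmoothAt′ (dx s + suc c) (s ∷ p) → SmoothAt′ (suc c) p
SmoothAt′-tail (inj₁ (refl , ()))
SmoothAt′-tail {s} (inj₂ (inj₁ (_ , e))) = ⊥-elim (m+1+n≢m (dx s) e)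
SmoothAt′-tail {s} {p = p} (inj₂ (inj₂ (_ , e , smooth))) =
  subst (λ c → SmoothAt′ c p) (sym (+-cancelˡ-≡ (dx s) _ _ e)) smooth

SmoothCols′-tail : ∀ {s c p} k → SmoothCols′ (dx s + suc c) k (s ∷ p) → SmoothCols′ (suc c) k p
SmoothCols′-tail zero    _ = tt
SmoothCols′-tail {s} {c} {p} (suc k) (smooth , smoothCols) =
  SmoothAt′-tail smooth ,
  SmoothCols′-tail k (subst (λ d → SmoothCols′ d k (s ∷ p)) (x∙yz≈y∙xz 3 (dx s) (suc c)) smoothCols)

SmoothCols′-cons : ∀ {s c p} k → SmoothCols′ c k p → SmoothCols′ (dx s + c) k (s ∷ p)
SmoothCols′-cons zero    _ = tt
SmoothCols′-cons {s} {c} {p} (suc k) (smooth , smoothCols) =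
  inj₂ (inj₂ (c , refl , smooth)) ,
  subst (λ d → SmoothCols′ d k (s ∷ p)) (sym (x∙yz≈y∙xz 3 (dx s) c)) (SmoothCols′-cons k smoothCols)

SmoothAt′⇒0< : ∀ {c p} → All InSC p → SmoothAt′ c p → 0 < c
SmoothAt′⇒0< (_ ∷ _) (inj₁ (_ , refl))             = s≤s z≤n
SmoothAt′⇒0< (i ∷ _) (inj₂ (inj₁ (_ , refl)))      = dx-positive i
SmoothAt′⇒0< (i ∷ _) (inj₂ (inj₂ (c′ , refl , _))) = <-≤-trans (dx-positive i) (m≤m+n _ c′)

crossing-smooth : ∀ v {q} → SmoothAt′ 1 (crossing v ++ q)
crossing-smooth level = inj₁ (refl , refl)
crossing-smooth rise  = inj₂ (inj₁ ((_ , refl) , refl))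
crossing-smooth fall  = inj₂ (inj₁ ((_ , refl) , refl))

crossing-cons : ∀ v {k q} → SmoothCols′ 2 k q → SmoothCols′ 4 k (crossing v ++ q)
crossing-cons level = SmoothCols′-cons _
crossing-cons rise  = SmoothCols′-cons _ ∘ SmoothCols′-cons _
crossing-cons fall  = SmoothCols′-cons _ ∘ SmoothCols′-cons _

crossing-tail : ∀ v {k q} → SmoothCols′ 4 k (crossing v ++ q) → SmoothCols′ 2 k q
crossing-tail level = SmoothCols′-tail _
crossing-tail rise  = SmoothCols′-tail _ ∘ SmoothCols′-tail _
crossing-tail fall  = SmoothCols′-tail _ ∘ SmoothCols′-tail _

crossing-view : ∀ {p} → All InSC p → SmoothAt′ 1 p → ∃₂ λ v q → p ≡ crossing v ++ q
crossing-view (_ ∷ _) (inj₁ (refl , refl)) = level , _ , refl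
crossing-view {up ∷ _}   _ (inj₂ (inj₁ ((_ , refl) , refl))) = rise , _ , refl
crossing-view {down ∷ _} _ (inj₂ (inj₁ ((_ , refl) , refl))) = fall , _ , refl
crossing-view {flat ∷ _} _ (inj₂ (inj₁ (_ , ())))
crossing-view {up ∷ _}   (_ ∷ inSC) (inj₂ (inj₂ (_ , refl , smooth))) =
  ⊥-elim (<-irrefl refl (SmoothAt′⇒0< inSC smooth))
crossing-view {down ∷ _} (_ ∷ inSC) (inj₂ (inj₂ (_ , refl , smooth))) =
  ⊥-elim (<-irrefl refl (SmoothAt′⇒0< inSC smooth))
crossing-view {flat ∷ _} _ (inj₂ (inj₂ (_ , () , _)))
crossing-view {vup ∷ _}   (() ∷ _) _
crossing-view {vdown ∷ _} (() ∷ _) _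

-- Widths are written k * 3 rather than 3 * k because suc k * 3 reduces to 3 + k * 3.
mutual
  blocks-of-smooth : ∀ k {p} → All InSC p → SmoothCols′ 2 k p → xEnd p ≡ k * 3 →
                     ∃ λ bs → p ≡ delannoyOf bs
  blocks-of-smooth zero {[]}    _        _ _ = [] , refl
  blocks-of-smooth zero {s ∷ p} (i ∷ _) _ e =
    ⊥-elim (<-irrefl (sym e) (<-≤-trans (dx-positive i) (m≤m+n (dx s) (xEnd p))))
  blocks-of-smooth (suc k) (_ ∷ _) (inj₁ (_ , ()) , _) _
  blocks-of-smooth (suc k) {up ∷ _} (_ ∷ inSC) (inj₂ (inj₂ (_ , refl , smooth)) , smoothCols) e
    with crossing-then-blocks k inSC smooth (SmoothCols′-tail k smoothCols) (suc-injective e)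
  ... | v , bs , refl = block hup v ∷ bs , refl
  blocks-of-smooth (suc k) {down ∷ _} (_ ∷ inSC) (inj₂ (inj₂ (_ , refl , smooth)) , smoothCols) e
    with crossing-then-blocks k inSC smooth (SmoothCols′-tail k smoothCols) (suc-injective e)
  ... | v , bs , refl = block hdown v ∷ bs , refl
  blocks-of-smooth (suc k) {flat ∷ _} (_ ∷ inSC) (inj₂ (inj₂ (_ , refl , smooth)) , _) _ =
    ⊥-elim (<-irrefl refl (SmoothAt′⇒0< inSC smooth))
  blocks-of-smooth (suc k) {up ∷ _}   _ (inj₂ (inj₁ (_ , ())) , _) _
  blocks-of-smooth (suc k) {down ∷ _} _ (inj₂ (inj₁ (_ , ())) , _) _
  blocks-of-smooth (suc zero) {flat ∷ _} _ (inj₂ (inj₁ ((_ , refl) , refl)) , _) ()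
  blocks-of-smooth (suc (suc k)) {flat ∷ _} (_ ∷ _ ∷ inSC)
                   (inj₂ (inj₁ ((_ , refl) , refl)) , smoothCols) e
    with SmoothCols′-tail (suc k) (SmoothCols′-tail (suc k) smoothCols)
  ... | smooth , smoothCols′ with crossing-then-blocks k inSC smooth smoothCols′ (+-cancelˡ-≡ 4 _ _ e)
  ... | v , bs , refl = block hflat v ∷ bs , refl
  blocks-of-smooth (suc k) {vup ∷ _}   (() ∷ _) _ _
  blocks-of-smooth (suc k) {vdown ∷ _} (() ∷ _) _ _

  crossing-then-blocks : ∀ k {p} → All InSC p → SmoothAt′ 1 p → SmoothCols′ 4 k p →
                         xEnd p ≡ 2 + k * 3 → ∃₂ λ v bs → p ≡ crossing v ++ delannoyOf bs
  crossing-then-blocks k inSC smooth smoothCols e with crossing-view inSC smooth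
  ... | v , q , refl
    with blocks-of-smooth k (++⁻ʳ (crossing v) inSC) (crossing-tail v smoothCols)
                          (+-cancelˡ-≡ 2 _ _ (trans (sym (xEnd-crossing v q)) e))
  ... | bs , refl = v , bs , refl

delannoyOf-smooth : ∀ bs → SmoothCols′ 2 (xEnd (cwOf bs)) (delannoyOf bs)
delannoyOf-smooth [] = tt
delannoyOf-smooth (block hup v ∷ bs) rewrite xEnd-vertical v (cwOf bs) =
  inj₂ (inj₂ (1 , refl , crossing-smooth v)) , SmoothCols′-cons _ (crossing-cons v (delannoyOf-smooth bs))
delannoyOf-smooth (block hdown v ∷ bs) rewrite xEnd-vertical v (cwOf bs) =
  inj₂ (inj₂ (1 , refl , crossing-smooth v)) , SmoothCols′-cons _ (crossing-cons v (delannoyOf-smooth bs))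
delannoyOf-smooth (block hflat v ∷ bs) rewrite xEnd-vertical v (cwOf bs) =
  inj₂ (inj₁ ((_ , refl) , refl)) ,
  SmoothCols′-cons _ (SmoothCols′-cons _ (crossing-smooth v , crossing-cons v (delannoyOf-smooth bs)))

-- Vertically constrained paths

VertConstrained′ : Path → Set
VertConstrained′ []      = ⊤
VertConstrained′ (s ∷ p) = (Vertical s → FirstInSC p) × VertConstrained′ p

VertConstrained⇒VertConstrained′ : ∀ p → VertConstrained p → VertConstrained′ p
VertConstrained⇒VertConstrained′ []      _  = tt
VertConstrained⇒VertConstrained′ (s ∷ p) vc = next p vc , VertConstrained⇒VertConstrained′ p tail
  where
  next : ∀ p → VertConstrained (s ∷ p) → Vertical s → FirstInSC p
  next []      _  _       = tt
  next (t ∷ p) vc s-vert = ¬Vertical⇒InSC t (λ t-vert → vc ([] , s , t , p , refl , s-vert , t-vert))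
  tail : VertConstrained p
  tail (xs , t , u , ys , refl , t-vert , u-vert) = vc (s ∷ xs , t , u , ys , refl , t-vert , u-vert)

VertConstrained′⇒VertConstrained : ∀ p → VertConstrained′ p → VertConstrained p
VertConstrained′⇒VertConstrained p vc′ (xs , s , t , ys , refl , s-vert , t-vert) = go xs vc′
  where
  go : ∀ xs → VertConstrained′ (xs ++ s ∷ t ∷ ys) → ⊥
  go []       (next , _) = InSC⇒¬Vertical (next s-vert) t-vert
  go (_ ∷ xs) (_ , vc′)  = go xs vc′

cwOf-FirstInSC : ∀ bs → FirstInSC (cwOf bs)
cwOf-FirstInSC []              = tt
cwOf-FirstInSC (block h _ ∷ _) = horizontal-InSC h

cwOf-VertConstrained′ : ∀ bs → VertConstrained′ (cwOf bs)
cwOf-VertConstrained′ []               = tt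
cwOf-VertConstrained′ (block h v ∷ bs) =
  (λ h-vert → ⊥-elim (InSC⇒¬Vertical (horizontal-InSC h) h-vert)) , after v
  where
  after : ∀ v → VertConstrained′ (vertical v ++ cwOf bs)
  after level = cwOf-VertConstrained′ bs
  after rise  = (λ _ → cwOf-FirstInSC bs) , cwOf-VertConstrained′ bs
  after fall  = (λ _ → cwOf-FirstInSC bs) , cwOf-VertConstrained′ bs

mutual
  blocks-of-cw : ∀ q → FirstInSC q → VertConstrained′ q → ∃ λ bs → q ≡ cwOf bs
  blocks-of-cw []         _ _        = [] , refl
  blocks-of-cw (up ∷ q)   _ (_ , vc) = after-horizontal hup q vc
  blocks-of-cw (down ∷ q) _ (_ , vc) = after-horizontal hdown q vc
  blocks-of-cw (flat ∷ q) _ (_ , vc) = after-horizontal hflat q vc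

  after-horizontal : ∀ h q → VertConstrained′ q → ∃ λ bs → horizontal h ∷ q ≡ cwOf bs
  after-horizontal h []         vc = level-block h [] tt vc
  after-horizontal h (up ∷ q)   vc = level-block h (up ∷ q) tt vc
  after-horizontal h (down ∷ q) vc = level-block h (down ∷ q) tt vc
  after-horizontal h (flat ∷ q) vc = level-block h (flat ∷ q) tt vc
  after-horizontal h (vup ∷ q) (next , vc) with blocks-of-cw q (next tt) vc
  ... | bs , refl = block h rise ∷ bs , refl
  after-horizontal h (vdown ∷ q) (next , vc) with blocks-of-cw q (next tt) vc
  ... | bs , refl = block h fall ∷ bs , refl

  level-block : ∀ h q → FirstInSC q → VertConstrained′ q → ∃ λ bs → horizontal h ∷ q ≡ cwOf bs
  level-block h q first vc with blocks-of-cw q first vc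
  ... | bs , refl = block h level ∷ bs , refl

horizontal-injective : ∀ h h′ → horizontal h ≡ horizontal h′ → h ≡ h′
horizontal-injective hup   hup   _ = refl
horizontal-injective hdown hdown _ = refl
horizontal-injective hflat hflat _ = refl
horizontal-injective hup   hdown ()
horizontal-injective hup   hflat ()
horizontal-injective hdown hup   ()
horizontal-injective hdown hflat ()
horizontal-injective hflat hup   ()
horizontal-injective hflat hdown ()

vertical-injective : ∀ v v′ {q q′} → FirstInSC q → FirstInSC q′ →
                     vertical v ++ q ≡ vertical v′ ++ q′ → v ≡ v′ × q ≡ q′
vertical-injective level level _  _  e    = refl , e
vertical-injective rise  rise  _  _  refl = refl , refl
vertical-injective fall  fall  _  _  refl = refl , refl
vertical-injective level rise  () _  refl
vertical-injective level fall  () _  refl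
vertical-injective rise  level _  () refl
vertical-injective fall  level _  () refl
vertical-injective rise  fall  _  _  ()
vertical-injective fall  rise  _  _  ()

cwOf-injective : ∀ {bs bs′} → cwOf bs ≡ cwOf bs′ → bs ≡ bs′
cwOf-injective {[]}            {[]}            _ = refl
cwOf-injective {[]}            {block _ _ ∷ _} ()
cwOf-injective {block _ _ ∷ _} {[]}            ()
cwOf-injective {block h v ∷ bs} {block h′ v′ ∷ bs′} e
  with ∷-injective e
... | eh , ev
  with horizontal-injective h h′ eh
     | vertical-injective v v′ (cwOf-FirstInSC bs) (cwOf-FirstInSC bs′) ev
... | refl | refl , e′ = cong (block h v ∷_) (cwOf-injective e′)

-- Non-negativity

NonNegFrom : ℤ → Path → Set
NonNegFrom y []      = + 0 ≤ℤ y
NonNegFrom y (s ∷ p) = + 0 ≤ℤ y × NonNegFrom (y +ℤ dy s) p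

NonNegFrom-head : ∀ {y} p → NonNegFrom y p → + 0 ≤ℤ y
NonNegFrom-head []      h       = h
NonNegFrom-head (_ ∷ _) (h , _) = h

NonNegFrom-resp : ∀ {y y′} p → y ≡ y′ → NonNegFrom y p → NonNegFrom y′ p
NonNegFrom-resp p refl h = h

prefixes⇒NonNegFrom : ∀ y p → All (λ q → + 0 ≤ℤ y +ℤ yEnd q) (inits p) → NonNegFrom y p
prefixes⇒NonNegFrom y []      (h ∷ []) = subst (+ 0 ≤ℤ_) (ℤ.+-identityʳ y) h
prefixes⇒NonNegFrom y (s ∷ p) (h ∷ hs) =
  subst (+ 0 ≤ℤ_) (ℤ.+-identityʳ y) h ,
  prefixes⇒NonNegFrom (y +ℤ dy s) p
    (All.map (λ {q} → subst (+ 0 ≤ℤ_) (sym (ℤ.+-assoc y (dy s) (yEnd q)))) (map⁻ {xs = inits p} hs))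

NonNegFrom⇒prefixes : ∀ y p → NonNegFrom y p → All (λ q → + 0 ≤ℤ y +ℤ yEnd q) (inits p)
NonNegFrom⇒prefixes y []      h       = subst (+ 0 ≤ℤ_) (sym (ℤ.+-identityʳ y)) h ∷ []
NonNegFrom⇒prefixes y (s ∷ p) (h , t) =
  subst (+ 0 ≤ℤ_) (sym (ℤ.+-identityʳ y)) h ∷
  map⁺ {xs = inits p}
    (All.map (λ {q} → subst (+ 0 ≤ℤ_) (ℤ.+-assoc y (dy s) (yEnd q)))
             (NonNegFrom⇒prefixes (y +ℤ dy s) p t))

NonNeg⇒NonNegFrom : ∀ p → NonNeg p → NonNegFrom (+ 0) p
NonNeg⇒NonNegFrom p nonNeg =
  prefixes⇒NonNegFrom (+ 0) p
    (All.map (λ {q} → subst (+ 0 ≤ℤ_) (sym (ℤ.+-identityˡ (yEnd q)))) (map⁻ {xs = inits p} nonNeg))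

NonNegFrom⇒NonNeg : ∀ p → NonNegFrom (+ 0) p → NonNeg p
NonNegFrom⇒NonNeg p nonNeg =
  map⁺ {xs = inits p}
    (All.map (λ {q} → subst (+ 0 ≤ℤ_) (ℤ.+-identityˡ (yEnd q))) (NonNegFrom⇒prefixes (+ 0) p nonNeg))

mutual
  delannoyOf⇒cwOf-NonNegFrom : ∀ y bs → NonNegFrom y (delannoyOf bs) → NonNegFrom y (cwOf bs)
  delannoyOf⇒cwOf-NonNegFrom y []                   h       = h
  delannoyOf⇒cwOf-NonNegFrom y (block hup v ∷ bs)   (h , t) = h , crossing⇒vertical-NonNegFrom _ v bs t
  delannoyOf⇒cwOf-NonNegFrom y (block hdown v ∷ bs) (h , t) = h , crossing⇒vertical-NonNegFrom _ v bs t
  delannoyOf⇒cwOf-NonNegFrom y (block hflat v ∷ bs) (h , _ , t) =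
    h , crossing⇒vertical-NonNegFrom _ v bs (NonNegFrom-resp _ (ℤ.+-identityʳ (y +ℤ + 0)) t)

  crossing⇒vertical-NonNegFrom : ∀ z v bs → NonNegFrom z (crossing v ++ delannoyOf bs) →
                                 NonNegFrom z (vertical v ++ cwOf bs)
  crossing⇒vertical-NonNegFrom z level bs (_ , t) =
    delannoyOf⇒cwOf-NonNegFrom z bs (NonNegFrom-resp _ (ℤ.+-identityʳ z) t)
  crossing⇒vertical-NonNegFrom z rise bs (h , _ , t) =
    h , delannoyOf⇒cwOf-NonNegFrom _ bs (NonNegFrom-resp _ (ℤ.+-assoc z (+ 1) (+ 1)) t)
  crossing⇒vertical-NonNegFrom z fall bs (h , _ , t) =
    h , delannoyOf⇒cwOf-NonNegFrom _ bs (NonNegFrom-resp _ (ℤ.+-assoc z -[1+ 0 ] -[1+ 0 ]) t)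

mutual
  cwOf⇒delannoyOf-NonNegFrom : ∀ y bs → NonNegFrom y (cwOf bs) → NonNegFrom y (delannoyOf bs)
  cwOf⇒delannoyOf-NonNegFrom y []                   h       = h
  cwOf⇒delannoyOf-NonNegFrom y (block hup v ∷ bs)   (h , t) = h , vertical⇒crossing-NonNegFrom _ v bs t
  cwOf⇒delannoyOf-NonNegFrom y (block hdown v ∷ bs) (h , t) = h , vertical⇒crossing-NonNegFrom _ v bs t
  cwOf⇒delannoyOf-NonNegFrom y (block hflat v ∷ bs) (h , t) =
    h , NonNegFrom-head (vertical v ++ cwOf bs) t ,
    NonNegFrom-resp _ (sym (ℤ.+-identityʳ (y +ℤ + 0))) (vertical⇒crossing-NonNegFrom _ v bs t)

  vertical⇒crossing-NonNegFrom : ∀ z v bs → NonNegFrom z (vertical v ++ cwOf bs) →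
                                 NonNegFrom z (crossing v ++ delannoyOf bs)
  vertical⇒crossing-NonNegFrom z level bs t =
    NonNegFrom-head (cwOf bs) t ,
    cwOf⇒delannoyOf-NonNegFrom _ bs (NonNegFrom-resp _ (sym (ℤ.+-identityʳ z)) t)
  vertical⇒crossing-NonNegFrom z rise bs (h , t) =
    h , ℤ.≤-trans h (ℤ.i≤i+j z (+ 1)) ,
    cwOf⇒delannoyOf-NonNegFrom _ bs (NonNegFrom-resp _ (sym (ℤ.+-assoc z (+ 1) (+ 1))) t)
  vertical⇒crossing-NonNegFrom z fall bs (h , t) =
    h , ℤ.≤-trans z-2≥0 (ℤ.i-j≤i (z +ℤ -[1+ 0 ]) (+ 1)) ,
    cwOf⇒delannoyOf-NonNegFrom _ bs (NonNegFrom-resp _ (sym (ℤ.+-assoc z -[1+ 0 ] -[1+ 0 ])) t)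
    where
    z-2≥0 : + 0 ≤ℤ z +ℤ -[1+ 0 ] +ℤ -[1+ 0 ]
    z-2≥0 = subst (+ 0 ≤ℤ_) (sym (ℤ.+-assoc z -[1+ 0 ] -[1+ 0 ])) (NonNegFrom-head (cwOf bs) t)

NonNeg-delannoyOf⇔cwOf : ∀ bs → NonNeg (delannoyOf bs) ⇔ NonNeg (cwOf bs)
NonNeg-delannoyOf⇔cwOf bs = mk⇔
  (λ nonNeg → NonNegFrom⇒NonNeg _ (delannoyOf⇒cwOf-NonNegFrom (+ 0) bs (NonNeg⇒NonNegFrom _ nonNeg)))
  (λ nonNeg → NonNegFrom⇒NonNeg _ (cwOf⇒delannoyOf-NonNegFrom (+ 0) bs (NonNeg⇒NonNegFrom _ nonNeg)))

BijOn-viaParameters : ∀ {I : Set} {f : Path → Path} {A B : Path → Set}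
  (P : I → Set) (d c : I → Path) →
  (∀ {i j} → c i ≡ c j → i ≡ j) →
  (∀ i → P i → f (d i) ≡ c i) →
  (∀ p → A p → ∃ λ i → P i × p ≡ d i) → (∀ i → P i → A (d i)) →
  (∀ q → B q → ∃ λ i → P i × q ≡ c i) → (∀ i → P i → B (c i)) →
  BijOn f A B
BijOn-viaParameters {f = f} {A} {B} P d c c-injective f∘d≡c A⇒P P⇒A B⇒P P⇒B =
  into , injective , onto
  where
  into : ∀ p → A p → B (f p)
  into p a with A⇒P p a
  ... | i , Pi , refl = subst B (sym (f∘d≡c i Pi)) (P⇒B i Pi)

  injective : ∀ p p′ → A p → A p′ → f p ≡ f p′ → p ≡ p′
  injective p p′ a a′ e with A⇒P p a | A⇒P p′ a′
  ... | i , Pi , refl | j , Pj , refl =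
    cong d (c-injective (trans (sym (f∘d≡c i Pi)) (trans e (f∘d≡c j Pj))))

  onto : ∀ q → B q → ∃ λ p → A p × f p ≡ q
  onto q b with B⇒P q b
  ... | i , Pi , refl = d i , P⇒A i Pi , f∘d≡c i Pi

EndsAt : ℕ → ℤ → List Block → Set
EndsAt n m bs = endpoint (cwOf bs) ≡ (+ n , m)

module _ {n : ℕ} {m : ℤ} where

  γ-blocks : ∀ bs → EndsAt n m bs → γ n (delannoyOf bs) ≡ cwOf bs
  γ-blocks bs end =
    γ-delannoyOf n bs (proj₁ (to (endpoint≡ (delannoyOf bs)) (from (endpoint-delannoyOf bs) end)))

  delannoy⇒blocks : ∀ p → Delannoy (3 * n) m p × SmoothCols n p →
                    ∃ λ bs → EndsAt n m bs × p ≡ delannoyOf bs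
  delannoy⇒blocks p ((inSC , end) , smooth)
    with blocks-of-smooth n inSC (SmoothCols⇒SmoothCols′ n smooth)
                          (trans (proj₁ (to (endpoint≡ p) end)) (*-comm 3 n))
  ... | bs , refl = bs , to (endpoint-delannoyOf bs) end , refl

  blocks⇒delannoy : ∀ bs → EndsAt n m bs →
                    Delannoy (3 * n) m (delannoyOf bs) × SmoothCols n (delannoyOf bs)
  blocks⇒delannoy bs end =
    (delannoyOf-InSC bs , from (endpoint-delannoyOf bs) end) ,
    SmoothCols′⇒SmoothCols n (subst (λ k → SmoothCols′ 2 k (delannoyOf bs))
                                    (proj₁ (to (endpoint≡ (cwOf bs)) end))
                                    (delannoyOf-smooth bs))

  cw⇒blocks : ∀ q → CWPath n m q → ∃ λ bs → EndsAt n m bs × q ≡ cwOf bs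
  cw⇒blocks q (vc , first , end) with blocks-of-cw q first (VertConstrained⇒VertConstrained′ q vc)
  ... | bs , refl = bs , end , refl

  blocks⇒cw : ∀ bs → EndsAt n m bs → CWPath n m (cwOf bs)
  blocks⇒cw bs end =
    VertConstrained′⇒VertConstrained _ (cwOf-VertConstrained′ bs) , cwOf-FirstInSC bs , end

  schroeder⇒blocks : ∀ p → Schroeder (3 * n) m p × SmoothCols n p →
                     ∃ λ bs → (EndsAt n m bs × NonNeg (cwOf bs)) × p ≡ delannoyOf bs
  schroeder⇒blocks p ((delannoy , nonNeg) , smooth) with delannoy⇒blocks p (delannoy , smooth)
  ... | bs , end , refl = bs , (end , to (NonNeg-delannoyOf⇔cwOf bs) nonNeg) , refl

  blocks⇒schroeder : ∀ bs → EndsAt n m bs × NonNeg (cwOf bs) →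
                     Schroeder (3 * n) m (delannoyOf bs) × SmoothCols n (delannoyOf bs)
  blocks⇒schroeder bs (end , nonNeg) =
    let delannoy , smooth = blocks⇒delannoy bs end
    in (delannoy , from (NonNeg-delannoyOf⇔cwOf bs) nonNeg) , smooth

  nonNegCW⇒blocks : ∀ q → CWPath n m q × NonNeg q →
                    ∃ λ bs → (EndsAt n m bs × NonNeg (cwOf bs)) × q ≡ cwOf bs
  nonNegCW⇒blocks q (cw , nonNeg) with cw⇒blocks q cw
  ... | bs , end , refl = bs , (end , nonNeg) , refl

  blocks⇒nonNegCW : ∀ bs → EndsAt n m bs × NonNeg (cwOf bs) →
                    CWPath n m (cwOf bs) × NonNeg (cwOf bs)
  blocks⇒nonNegCW bs (end , nonNeg) = blocks⇒cw bs end , nonNeg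

theorem22 : (n : ℕ) (m : ℤ) →
    BijOn (γ n)
          (λ p → Schroeder (3 * n) m p × SmoothCols n p)
          (λ q → CWPath n m q × NonNeg q)
    × BijOn (γ n)
          (λ p → Delannoy (3 * n) m p × SmoothCols n p)
          (λ q → CWPath n m q)
theorem22 n m =
  BijOn-viaParameters (λ bs → EndsAt n m bs × NonNeg (cwOf bs)) delannoyOf cwOf cwOf-injective
    (λ bs → γ-blocks bs ∘ proj₁)
    schroeder⇒blocks blocks⇒schroeder nonNegCW⇒blocks blocks⇒nonNegCW ,
  BijOn-viaParameters (EndsAt n m) delannoyOf cwOf cwOf-injective
    γ-blocks delannoy⇒blocks blocks⇒delannoy cw⇒blocks blocks⇒cw
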